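{- Let $N$ be a finite set with a binary operation $-$ and a set $T=\{t_i\}$ of maps $t_i:N\to N$ such that: for all $a,b\in N$ there is a unique $t_i\in T$ with $t_ia=b$; for all $a,b\in N$ the equation $a-x=b$ has a unique solution $x\in N$; and $a-b=t_ia-t_ib$ for all $a,b\in N$ and all $t_i\in T$. Fix $a_0\in N$, for each $b\in N$ let $t_b$ be the unique element of $T$ with $t_ba_0=b$, and define $x+y:=t_yx$ for $x,y\in N$. Then $(N,+)$ is a quasigroup.
   Context: A quasigroup is a set $S$ with a binary operation $\circ$ such that for all $a,b\in S$ each of the equations $a\circ x=b$ and $y\circ a=b$ has a unique solution. -}

module Defs where

open import Level using (Level)
open import Data.Product using (Σ; _×_; _,_; proj₁)
open import Relation.Binary.PropositionalEquality using (_≡_)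

∃! : ∀ {a ℓ} (A : Set a) → (A → Set ℓ) → Set _
∃! A P = Σ A (λ x → P x × (∀ y → P y → x ≡ y))

IsQuasigroup : ∀ {a} (S : Set a) → (S → S → S) → Set a
IsQuasigroup S _∘_ =
  (∀ a b → ∃! S (λ x → a ∘ x ≡ b)) × (∀ a b → ∃! S (λ y → y ∘ a ≡ b))

plusOp : ∀ {n i} {N : Set n} {I : Set i} (t : I → N → N)
         → (uniqT : ∀ a b → ∃! I (λ k → t k a ≡ b))
         → (a₀ : N) → N → N → N
plusOp t uniqT a₀ x y = t (proj₁ (uniqT a₀ y)) x

-- For a ∈ N the maps k ↦ t_k a are bijections I → N, so the index b ↦ t_b is
-- inverse to k ↦ t_k a₀. Hence a + x = t_x a = b holds exactly when t_x is the
-- unique t_j with t_j a = b, i.e. when x = t_j a₀. For the other side, each t_k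
-- preserves differences, so it is injective by left cancellation of -, and it is
-- onto: if a₀ - y = t_k a₀ - b then t_k a₀ - t_k y = t_k a₀ - b, so t_k y = b.
module Submission where

open import Defs
open import Data.Nat using (ℕ)
open import Data.Fin using (Fin)
open import Data.Product using (_,_; proj₁; proj₂)
open import Level using (Level)
open import Algebra.Core using (Op₂)
open import Algebra.Definitions using (LeftCancellative)
open import Function.Bundles using (_↔_)
open import Function.Definitions using (Injective)
open import Relation.Binary.PropositionalEquality
  using (_≡_; refl; sym; trans; cong; module ≡-Reasoning)

private
  variable
    a i ℓ : Level

∃!-unique : {A : Set a} {P : A → Set ℓ} → ∃! A P → ∀ {x y} → P x → P y → x ≡ y
∃!-unique (_ , _ , unique) px py = trans (sym (unique _ px)) (unique _ py)

∃!-solvable⇒leftCancellative : {A : Set a} (_-_ : Op₂ A) →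
  (∀ x y → ∃! A (λ z → x - z ≡ y)) → LeftCancellative _≡_ _-_
∃!-solvable⇒leftCancellative _-_ solve x y z eq = ∃!-unique (solve x (x - z)) eq refl

module DifferencePreserving
  {N : Set a} {I : Set i} (_-_ : Op₂ N) (t : I → N → N)
  (solve : ∀ x y → ∃! N (λ z → x - z ≡ y))
  (preserves : ∀ k x y → x - y ≡ t k x - t k y)
  where

  private
    cancel : LeftCancellative _≡_ _-_
    cancel = ∃!-solvable⇒leftCancellative _-_ solve

  t-injective : ∀ k → Injective _≡_ _≡_ (t k)
  t-injective k {x} {y} tx≡ty = cancel x x y (begin
    x - x         ≡⟨ preserves k x x ⟩
    t k x - t k x ≡⟨ cong (t k x -_) tx≡ty ⟩
    t k x - t k y ≡⟨ preserves k x y ⟨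
    x - y         ∎)
    where open ≡-Reasoning

  t-∃!-preimage : ∀ a₀ k y → ∃! N (λ x → t k x ≡ y)
  t-∃!-preimage a₀ k y = x , tx≡y , λ x′ tx′≡y → t-injective k (trans tx≡y (sym tx′≡y))
    where
    x : N
    x = proj₁ (solve a₀ (t k a₀ - y))

    tx≡y : t k x ≡ y
    tx≡y = cancel (t k a₀) (t k x) y
      (trans (sym (preserves k a₀ x)) (proj₁ (proj₂ (solve a₀ (t k a₀ - y)))))

module Indexing
  {N : Set a} {I : Set i} (t : I → N → N)
  (uniqT : ∀ x y → ∃! I (λ k → t k x ≡ y))
  (a₀ : N)
  where

  index : N → I
  index y = proj₁ (uniqT a₀ y)

  index-spec : ∀ y → t (index y) a₀ ≡ y
  index-spec y = proj₁ (proj₂ (uniqT a₀ y))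

  index-orbit : ∀ k → index (t k a₀) ≡ k
  index-orbit k = proj₂ (proj₂ (uniqT a₀ (t k a₀))) k refl

  ∃!-index-solution : ∀ x y → ∃! N (λ z → t (index z) x ≡ y)
  ∃!-index-solution x y = t j a₀ , solves , unique
    where
    j : I
    j = proj₁ (uniqT x y)

    solves : t (index (t j a₀)) x ≡ y
    solves = trans (cong (λ k → t k x) (index-orbit j)) (proj₁ (proj₂ (uniqT x y)))

    unique : ∀ z → t (index z) x ≡ y → t j a₀ ≡ z
    unique z eq = trans (cong (λ k → t k a₀) (proj₂ (proj₂ (uniqT x y)) (index z) eq))
                        (index-spec z)

mainTheorem4 : (N : Set) (I : Set) (n : ℕ) → N ↔ Fin n
    → (_-_ : N → N → N) (t : I → N → N)
    → (uniqT : ∀ a b → ∃! I (λ k → t k a ≡ b))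
    → (∀ a b → ∃! N (λ x → (a - x) ≡ b))
    → (∀ (k : I) a b → (a - b) ≡ (t k a - t k b))
    → (a₀ : N)
    → IsQuasigroup N (plusOp t uniqT a₀)
mainTheorem4 N I n _ _-_ t uniqT solve preserves a₀ =
  ∃!-index-solution , λ x y → t-∃!-preimage a₀ (index x) y
  where
  open Indexing t uniqT a₀
  open DifferencePreserving _-_ t solve preserves
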